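{- For every $n\in\mathbb{N}$ and every $\pi \in \mathfrak{S}_n$, there is at least one MVP parking function $\alpha$ of length $n$ with $\mathcal{O}_{\mathrm{MVP}_n}(\alpha)=\pi$.
   Context: Permutations are written in one-line notation $\pi=(\pi_1,\dots,\pi_n)$. Spots $1,\dots,n$ on a one-way street; cars $1,\dots,n$ arrive in order with preferences $\alpha=(a_1,\dots,a_n)\in[n]^n$. MVP parking rule: when car $i$ arrives, if spot $a_i$ is unoccupied, car $i$ parks there; if spot $a_i$ is occupied by an earlier car $j$, then car $i$ parks in spot $a_i$ and car $j$ is bumped and parks in the first unoccupied spot among $a_i+1,\dots,n$, if any (otherwise car $j$ fails to park); a bumped car never bumps another car. $\alpha$ is an MVP parking function if all cars park. The outcome $\mathcal{O}_{\mathrm{MVP}_n}(\alpha)=(\pi_1,\dots,\pi_n)$ is the permutation where car $\pi_j$ is parked in spot $j$ at the end. -}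

module Defs where

open import Data.Nat using (ℕ; zero; suc)
open import Data.Fin using (Fin; zero; suc; toℕ; _<_; _<?_)
open import Data.Fin.Permutation using (Permutation′; _⟨$⟩ʳ_)
open import Data.Vec using (Vec; []; _∷_; lookup; tabulate; _[_]≔_; replicate)
open import Data.Maybe using (Maybe; just; nothing; _>>=_)
open import Data.List using (List; []; _∷_)
open import Data.List as L using (allFin)
open import Relation.Nullary using (yes; no)
open import Data.Maybe using (Is-just)
open import Relation.Binary.PropositionalEquality using (_≡_)

-- Street configuration: spot ↦ car parked there (nothing = unoccupied).
Config : ℕ → Set
Config n = Vec (Maybe (Fin n)) n

firstFree : ∀ {n} → Config n → List (Fin n) → Maybe (Fin n)
firstFree c [] = nothing
firstFree c (s ∷ ss) with lookup c s
... | nothing = just s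
... | just _  = firstFree c ss

spotsAfter : ∀ {n} → Fin n → List (Fin n)
spotsAfter {n} a = L.filter (λ s → a <? s) (allFin n)

parkMVP : ∀ {n} → Config n → Fin n → Fin n → Maybe (Config n)
parkMVP c i a with lookup c a
... | nothing = just (c [ a ]≔ just i)
... | just j with firstFree c (spotsAfter a)
...   | nothing = nothing
...   | just s  = just ((c [ a ]≔ just i) [ s ]≔ just j)

runMVP : ∀ {n} → Config n → List (Fin n) → (Fin n → Fin n) → Maybe (Config n)
runMVP c [] α = just c
runMVP c (i ∷ is) α = parkMVP c i (α i) >>= λ c′ → runMVP c′ is α

finalMVP : ∀ {n} → (Fin n → Fin n) → Maybe (Config n)
finalMVP {n} α = runMVP (replicate n nothing) (allFin n) α

IsMVPParkingFunction : ∀ {n} → (Fin n → Fin n) → Set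
IsMVPParkingFunction α = Is-just (finalMVP α)

-- Outcome O_MVP(α) = π means: all cars park and car π_j is in spot j.
-- (Since every car parks, the final configuration is total.)
OutcomeIs : ∀ {n} → (Fin n → Fin n) → Permutation′ n → Set
OutcomeIs {n} α π = finalMVP α ≡ just (tabulate (λ j → just (π ⟨$⟩ʳ j)))

-- Let car i prefer spot π⁻¹(i), the spot it must end in. Preferences are then pairwise
-- distinct, so every car finds its preferred spot free and no bumping ever happens:
-- while cars are still arriving, a spot is empty exactly when its car has not yet arrived.
module Submission where

open import Defs
open import Data.Nat using (ℕ)
open import Data.Fin using (Fin)
open import Data.Fin.Properties using (_≟_)
open import Data.Fin.Permutation using (Permutation′; _⟨$⟩ʳ_; _⟨$⟩ˡ_; inverseʳ; inverseˡ)
open import Data.Product using (Σ; _×_; _,_; proj₁; proj₂)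
open import Data.Vec using (lookup; tabulate; _[_]≔_; replicate)
open import Data.Vec.Properties using (lookup∘update; lookup∘update′; lookup-replicate; tabulate∘lookup; tabulate-cong)
open import Data.Maybe using (just; nothing)
open import Data.Maybe.Relation.Unary.Any using (just)
open import Data.List using (List; []; _∷_; allFin)
open import Data.List.Membership.Propositional using (_∈_; _∉_)
open import Data.List.Membership.Propositional.Properties using (∈-allFin)
open import Data.List.Relation.Unary.Any using (here; there)
open import Data.List.Relation.Unary.All.Properties using (All¬⇒¬Any)
open import Data.List.Relation.Unary.Unique.Propositional using (Unique; []; _∷_)
open import Data.List.Relation.Unary.Unique.Propositional.Properties using (allFin⁺)
open import Data.Unit using (tt)
open import Data.Empty using (⊥-elim)
open import Relation.Nullary using (yes; no)
open import Relation.Binary.PropositionalEquality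

parkMVP-free : ∀ {n} (c : Config n) i a → lookup c a ≡ nothing →
               parkMVP c i a ≡ just (c [ a ]≔ just i)
parkMVP-free c i a free with lookup c a
... | nothing = refl

module _ {n : ℕ} (π : Permutation′ n) where

  preference : Fin n → Fin n
  preference i = π ⟨$⟩ˡ i

  outcome : Config n
  outcome = tabulate (λ j → just (π ⟨$⟩ʳ j))

  Awaiting : List (Fin n) → Config n → Set
  Awaiting is c = ∀ j → (π ⟨$⟩ʳ j ∈ is → lookup c j ≡ nothing)
                      × (π ⟨$⟩ʳ j ∉ is → lookup c j ≡ just (π ⟨$⟩ʳ j))

  Awaiting-empty : Awaiting (allFin n) (replicate n nothing)
  Awaiting-empty j = (λ _ → lookup-replicate j nothing) , (λ ∉all → ⊥-elim (∉all (∈-allFin _)))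

  Awaiting-[] : ∀ {c} → Awaiting [] c → c ≡ outcome
  Awaiting-[] {c} aw = begin
    c                        ≡⟨ tabulate∘lookup c ⟨
    tabulate (lookup c)      ≡⟨ tabulate-cong (λ j → proj₂ (aw j) (λ ())) ⟩
    outcome                  ∎
    where open ≡-Reasoning

  preference-free : ∀ {c i is} → Awaiting (i ∷ is) c → lookup c (preference i) ≡ nothing
  preference-free aw = proj₁ (aw _) (here (inverseʳ π))

  Awaiting-park : ∀ {c i is} → i ∉ is → Awaiting (i ∷ is) c →
                  Awaiting is (c [ preference i ]≔ just i)
  Awaiting-park {c} {i} {is} i∉is aw j with j ≟ preference i
  ... | yes refl = (λ i∈is → ⊥-elim (i∉is (subst (_∈ is) (inverseʳ π) i∈is)))
                 , (λ _ → trans (lookup∘update (preference i) c (just i)) (cong just (sym (inverseʳ π))))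
  ... | no j≢pi  = (λ ∈is → trans unchanged (proj₁ (aw j) (there ∈is)))
                 , (λ ∉is → trans unchanged (proj₂ (aw j) λ { (here eq) → other-car eq ; (there ∈is) → ∉is ∈is }))
    where
    unchanged : lookup (c [ preference i ]≔ just i) j ≡ lookup c j
    unchanged = lookup∘update′ j≢pi c (just i)

    other-car : π ⟨$⟩ʳ j ≢ i
    other-car eq = j≢pi (trans (sym (inverseˡ π)) (cong (π ⟨$⟩ˡ_) eq))

  runMVP-Awaiting : ∀ {c is} → Unique is → Awaiting is c → runMVP c is preference ≡ just outcome
  runMVP-Awaiting {is = []} [] aw = cong just (Awaiting-[] aw)
  runMVP-Awaiting {c} {i ∷ is} (i∉is ∷ uniq) aw
    rewrite parkMVP-free c i (preference i) (preference-free {c} aw)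
    = runMVP-Awaiting uniq (Awaiting-park {c} (All¬⇒¬Any i∉is) aw)

corollary2p7 : (n : ℕ) → (π : Permutation′ n) →
    Σ (Fin n → Fin n) (λ α → IsMVPParkingFunction α × OutcomeIs α π)
corollary2p7 n π = preference π , parks , final
  where
  final : finalMVP (preference π) ≡ just (outcome π)
  final = runMVP-Awaiting π (allFin⁺ n) (Awaiting-empty π)

  parks : IsMVPParkingFunction (preference π)
  parks rewrite final = just tt
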